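{- Let $\Sigma$ be an implicational base over a finite set $U$ which is not premise-connected, and let $C$ be a premise-connected component of $\Sigma$. Then $\Sigma$ is H-decomposable if and only if both $\Sigma[C]$ (as a base over $C$) and $\Sigma[U\setminus C]$ (as a base over $U\setminus C$) are H-decomposable.
   Context: An implication over $U$ is written $A \to b$ with $A \subseteq U$ nonempty and $b \in U$; an implicational base over $U$ is a finite set of implications over $U$. For $X\subseteq U$, $\Sigma[X]=\{A\to b\in\Sigma : A\cup\{b\}\subseteq X\}$. A premise-path is a sequence $v_1,\dots,v_k$ of distinct elements of $U$ such that for each $1\le i<k$ some $A_i\to b_i\in\Sigma$ has $\{v_i,v_{i+1}\}\subseteq A_i$; $\Sigma$ is premise-connected if every two elements of $U$ are joined by a premise-path; a premise-connected component is an inclusion-maximal subset $C\subseteq U$ such that every two elements of $C$ are joined by a premise-path in $\Sigma$. A $\Sigma$-tree is a pair $(T,\lambda)$ where $T$ is a full rooted binary tree (every interior node has exactly two, unordered, children) and $\lambda$ labels the nodes so that: (1) each leaf is labelled by an element of $U$; (2) each interior node $t$ has $\lambda(t)\subseteq\Sigma$ (possibly empty); (3) for every interior node $t$ and every $A\to b\in\lambda(t)$, all elements of $A$ label leaves in the subtree of one child of $t$ and $b$ labels a leaf in the subtree of the other child; (4) each element of $U$ labels exactly one leaf and each implication of $\Sigma$ lies in the label of exactly one interior node. $\Sigma$ is H-decomposable if it has a $\Sigma$-tree; a base over the empty set is H-decomposable by convention. -}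

module Defs where

open import Data.Nat using (ℕ)
open import Data.Bool using (Bool)
import Data.Bool as Bool
open import Data.Fin using (Fin)
import Data.Fin as Fin
open import Data.Fin.Subset using (Subset; Nonempty; Empty; _⊆_; ⊤)
  renaming (_∈_ to _∈ₛ_)
open import Data.Fin.Subset.Properties using (_⊆?_; _∈?_)
open import Data.Product using (Σ; _×_; _,_; proj₁; proj₂; ∃)
open import Data.Product.Properties using () renaming (≡-dec to ×-≡-dec)
open import Data.Sum using (_⊎_)
open import Data.Unit using () renaming (⊤ to Unit)
open import Data.Maybe using (Maybe; just)
open import Data.List using (List; []; _∷_; _++_; filter; length; last; head)
open import Data.List.Relation.Unary.Unique.Propositional using (Unique)
open import Data.List.Relation.Unary.Linked using (Linked)
import Data.List.Membership.Propositional as MemP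
import Data.List.Membership.DecPropositional as MemD
open import Data.Vec.Properties using () renaming (≡-dec to vec-≡-dec)
open import Relation.Binary.PropositionalEquality using (_≡_)
open import Relation.Binary.Definitions using (DecidableEquality)
open import Relation.Nullary using (¬_; Dec)
open import Relation.Nullary.Decidable using (_×-dec_)
open import Function.Bundles using (_⇔_)

-- The finite ground set U is Fin n; subsets of U are `Subset n`.

Imp : ℕ → Set
Imp n = Subset n × Fin n

premise : ∀ {n} → Imp n → Subset n
premise = proj₁

concl : ∀ {n} → Imp n → Fin n
concl = proj₂

_≟ᵢ_ : ∀ {n} → DecidableEquality (Imp n)
_≟ᵢ_ = ×-≡-dec (vec-≡-dec Bool._≟_) Fin._≟_

-- An implicational base: a finite set of implications, given as a list
-- (list membership is used throughout, so duplicates are immaterial).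
Base : ℕ → Set
Base n = List (Imp n)

_∈ᵢ_ : ∀ {n} → Imp n → Base n → Set
_∈ᵢ_ = MemP._∈_

_∈ₗ_ : ∀ {n} → Fin n → List (Fin n) → Set
_∈ₗ_ = MemP._∈_

IsBaseOver : ∀ {n} → Subset n → Base n → Set
IsBaseOver X Σ' = ∀ s → s ∈ᵢ Σ' →
  Nonempty (premise s) × premise s ⊆ X × concl s ∈ₛ X

restrict : ∀ {n} → Base n → Subset n → Base n
restrict Σ' X = filter (λ s → (premise s ⊆? X) ×-dec (concl s ∈? X)) Σ'

PremAdj : ∀ {n} → Base n → Fin n → Fin n → Set
PremAdj Σ' u v = ∃ λ s → s ∈ᵢ Σ' × u ∈ₛ premise s × v ∈ₛ premise s

IsPremisePath : ∀ {n} → Base n → List (Fin n) → Set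
IsPremisePath Σ' vs = Unique vs × Linked (PremAdj Σ') vs

Joined : ∀ {n} → Base n → Fin n → Fin n → Set
Joined Σ' u v = ∃ λ vs → IsPremisePath Σ' vs × head vs ≡ just u × last vs ≡ just v

PremiseConnected : ∀ {n} → Base n → Set
PremiseConnected Σ' = ∀ u v → Joined Σ' u v

AllJoined : ∀ {n} → Base n → Subset n → Set
AllJoined Σ' C = ∀ u v → u ∈ₛ C → v ∈ₛ C → Joined Σ' u v

IsPremiseComponent : ∀ {n} → Base n → Subset n → Set
IsPremiseComponent Σ' C =
  AllJoined Σ' C × (∀ D → C ⊆ D → AllJoined Σ' D → D ⊆ C)

-- full rooted binary trees; leaves labelled by elements of U, interior
-- nodes labelled by finite sets (lists) of implications; children unordered
-- (condition (3) below is symmetric in the two children).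
data Tree (n : ℕ) : Set where
  leaf : Fin n → Tree n
  node : Base n → Tree n → Tree n → Tree n

leaves : ∀ {n} → Tree n → List (Fin n)
leaves (leaf u) = u ∷ []
leaves (node _ l r) = leaves l ++ leaves r

labels : ∀ {n} → Tree n → List (Base n)
labels (leaf _) = []
labels (node L l r) = L ∷ labels l ++ labels r

SubsetIn : ∀ {n} → Subset n → List (Fin n) → Set
SubsetIn A xs = ∀ x → x ∈ₛ A → x ∈ₗ xs

Separated : ∀ {n} → Tree n → Set
Separated (leaf _) = Unit
Separated (node L l r) =
  (∀ s → s ∈ᵢ L →
      (SubsetIn (premise s) (leaves l) × concl s ∈ₗ leaves r)
    ⊎ (SubsetIn (premise s) (leaves r) × concl s ∈ₗ leaves l))
  × Separated l × Separated r

occurrences : ∀ {n} → Imp n → Tree n → ℕ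
occurrences s t = length (filter (λ L → MemD._∈?_ _≟ᵢ_ s L) (labels t))

IsΣTree : ∀ {n} → Subset n → Base n → Tree n → Set
IsΣTree X Σ' t =
    (∀ u → u ∈ₗ leaves t → u ∈ₛ X)
  × (∀ u → u ∈ₛ X → u ∈ₗ leaves t)
  × Unique (leaves t)
  × (∀ L → MemP._∈_ L (labels t) → ∀ s → s ∈ᵢ L → s ∈ᵢ Σ')
  × Separated t
  × (∀ s → s ∈ᵢ Σ' → occurrences s t ≡ 1)

-- H-decomposable (the base over the empty set is H-decomposable by convention)
HDecomposable : ∀ {n} → Subset n → Base n → Set
HDecomposable X Σ' = Empty X ⊎ ∃ λ t → IsΣTree X Σ' t

-- Restricting a Σ-tree to the leaves lying in X (dropping leaves outside X, contracting nodes left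
-- with one child, and keeping in each label only the implications inside X) yields a Σ[X]-tree: an
-- implication inside X labelling a node has leaves of X below both of its children, so that node
-- survives. Conversely, C is closed under premise-adjacency by maximality, so no premise meets both
-- C and its complement; hence Σ[C]- and Σ[∁ C]-trees become the two subtrees of a Σ-tree whose root
-- carries the remaining implications, each of which has its premise on one side and its conclusion
-- on the other. Both sides are nonempty because Σ is not premise-connected.

module Submission where

open import Defs
open import Data.Nat using (ℕ; zero; suc; _+_)
open import Data.Nat.Properties using (+-identityʳ)
open import Data.Fin using (Fin; _≟_)
import Data.Fin as Fin
open import Data.Fin.Subset using (Subset; ⊤; ∁; _∪_; ⁅_⁆; _⊆_; Empty; Nonempty) renaming (_∈_ to _∈ₛ_)
open import Data.Fin.Subset.Properties
  using (x∈p∪q⁺; x∈p∪q⁻; x∈⁅x⁆; x∈⁅y⁆⇒x≡y; _∈?_; _⊆?_; ∈⊤; x∉p⇒x∈∁p; x∉∁p⇒x∈p; x∈∁p⇒x∉p)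
open import Data.Product using (_×_; _,_; proj₁; proj₂; ∃)
open import Data.Sum using (_⊎_; inj₁; inj₂)
open import Data.Maybe using (Maybe; just; nothing; maybe; Is-just)
open import Data.Maybe.Relation.Unary.All using (just; nothing) renaming (All to Allᴹ)
open import Data.Maybe.Relation.Unary.Any using (just)
open import Data.List using (List; []; _∷_; _++_; head; last; length; filter)
open import Data.List.Properties
  using (filter-++; filter-accept; filter-reject; filter-none; length-++; ++-identityʳ)
open import Data.List.Membership.Propositional.Properties using (∈-filter⁺; ∈-filter⁻; ∈-++⁺ˡ; ∈-++⁺ʳ; ∈-++⁻)
import Data.List.Relation.Unary.All as All
import Data.List.Relation.Unary.Unique.Propositional.Properties as UniqueProperties
open import Data.List.Relation.Unary.Any using (here; there)
open import Data.List.Relation.Unary.All.Properties using (¬Any⇒All¬)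
open import Data.List.Relation.Unary.AllPairs using ([]; _∷_)
open import Data.List.Relation.Unary.All using ([])
open import Data.List.Relation.Unary.Linked using (Linked; []; [-]; _∷_)
import Data.List.Relation.Unary.Linked as Linked
open import Data.List.Relation.Unary.Unique.Propositional using (Unique)
open import Data.List.Membership.Propositional using (_∈_)
import Data.List.Membership.DecPropositional as DecMembership
open import Data.Empty using (⊥-elim)
open import Function using (_∘_; case_of_)
open import Function.Bundles using (_⇔_; mk⇔)
open import Relation.Binary.Core using (Rel)
open import Relation.Binary.Definitions using (DecidableEquality)
open import Relation.Binary.PropositionalEquality
  using (_≡_; refl; sym; trans; cong; cong₂; subst; module ≡-Reasoning)
open import Relation.Binary.Construct.Closure.ReflexiveTransitive using (Star; ε; _◅_; _◅◅_; reverse)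
open import Relation.Nullary using (¬_; Dec; yes; no; ¬?)
open import Relation.Nullary.Decidable using (_×-dec_)

module _ {A : Set} (_≟ᴬ_ : DecidableEquality A) (x : A) where

  suffixFrom : List A → List A
  suffixFrom [] = []
  suffixFrom (w ∷ ws) with w ≟ᴬ x
  ... | yes _ = w ∷ ws
  ... | no _ = suffixFrom ws

  head-suffixFrom : ∀ {vs} → x ∈ vs → head (suffixFrom vs) ≡ just x
  head-suffixFrom {w ∷ ws} x∈ with w ≟ᴬ x | x∈
  ... | yes w≡x | _ = cong just w≡x
  ... | no w≢x | here x≡w = ⊥-elim (w≢x (sym x≡w))
  ... | no _ | there x∈ws = head-suffixFrom x∈ws

  last-suffixFrom : ∀ {vs} → x ∈ vs → last (suffixFrom vs) ≡ last vs
  last-suffixFrom {w ∷ ws} x∈ with w ≟ᴬ x | x∈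
  ... | yes _ | _ = refl
  ... | no w≢x | here x≡w = ⊥-elim (w≢x (sym x≡w))
  last-suffixFrom {w ∷ y ∷ ys} _ | no _ | there x∈ws = last-suffixFrom x∈ws

  suffixFrom-unique : ∀ {vs} → Unique vs → Unique (suffixFrom vs)
  suffixFrom-unique {[]} u = u
  suffixFrom-unique {w ∷ ws} u@(_ ∷ u′) with w ≟ᴬ x
  ... | yes _ = u
  ... | no _ = suffixFrom-unique u′

  suffixFrom-linked : ∀ {ℓ} {R : Rel A ℓ} {vs} → Linked R vs → Linked R (suffixFrom vs)
  suffixFrom-linked {vs = []} l = l
  suffixFrom-linked {vs = w ∷ ws} l with w ≟ᴬ x
  ... | yes _ = l
  ... | no _ = suffixFrom-linked (Linked.tail l)

linked⇒star : ∀ {A : Set} {ℓ} {R : Rel A ℓ} {u v} ws → Linked R (u ∷ ws) → last (u ∷ ws) ≡ just v → Star R u v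
linked⇒star [] [-] refl = ε
linked⇒star (w ∷ ws) (r ∷ l) e = r ◅ linked⇒star ws l e

module _ {n : ℕ} {Σ' : Base n} where

  open DecMembership (_≟_ {n}) using () renaming (_∈?_ to _∈ₗ?_)

  PremiseReachable : Fin n → Fin n → Set
  PremiseReachable = Star (PremAdj Σ')

  PremAdj-sym : ∀ {u v} → PremAdj Σ' u v → PremAdj Σ' v u
  PremAdj-sym (s , s∈Σ , u∈ , v∈) = s , s∈Σ , v∈ , u∈

  joined⇒reachable : ∀ {u v} → Joined Σ' u v → PremiseReachable u v
  joined⇒reachable ([] , _ , () , _)
  joined⇒reachable (u ∷ ws , (_ , linked) , refl , lastIsV) = linked⇒star ws linked lastIsV

  -- Loop erasure: if x is already on the path, start the path at x instead.
  PremAdj-joined : ∀ {x u v} → PremAdj Σ' x u → Joined Σ' u v → Joined Σ' x v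
  PremAdj-joined _ ([] , _ , () , _)
  PremAdj-joined {x} adj (u ∷ ws , (unique , linked) , refl , lastIsV) with x ∈ₗ? (u ∷ ws)
  ... | yes x∈ = suffixFrom _≟_ x (u ∷ ws)
               , (suffixFrom-unique _≟_ x unique , suffixFrom-linked _≟_ x linked)
               , head-suffixFrom _≟_ x x∈ , trans (last-suffixFrom _≟_ x x∈) lastIsV
  ... | no x∉ = x ∷ u ∷ ws , (¬Any⇒All¬ _ x∉ ∷ unique , adj ∷ linked) , refl , lastIsV

  reachable⇒joined : ∀ {u v} → PremiseReachable u v → Joined Σ' u v
  reachable⇒joined {u} ε = u ∷ [] , ([] ∷ [] , [-]) , refl , refl
  reachable⇒joined (adj ◅ path) = PremAdj-joined adj (reachable⇒joined path)

  component-closed : ∀ {C u x} → IsPremiseComponent Σ' C → u ∈ₛ C → PremAdj Σ' u x → x ∈ₛ C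
  component-closed {C} {u} {x} (joined , maximal) u∈C adj =
    maximal (C ∪ ⁅ x ⁆) (x∈p∪q⁺ ∘ inj₁) allJoined (x∈p∪q⁺ (inj₂ (x∈⁅x⁆ x)))
    where
    reachesU : ∀ {a} → a ∈ₛ C ∪ ⁅ x ⁆ → PremiseReachable a u
    reachesU {a} a∈ with x∈p∪q⁻ C ⁅ x ⁆ a∈
    ... | inj₁ a∈C = joined⇒reachable (joined a u a∈C u∈C)
    ... | inj₂ a∈⁅x⁆ rewrite x∈⁅y⁆⇒x≡y x a∈⁅x⁆ = PremAdj-sym adj ◅ ε
    allJoined : AllJoined Σ' (C ∪ ⁅ x ⁆)
    allJoined a b a∈ b∈ = reachable⇒joined (reachesU a∈ ◅◅ reverse PremAdj-sym (reachesU b∈))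

  component-nonempty : ∀ {C} → IsPremiseComponent Σ' C → Fin n → ¬ Empty C
  component-nonempty {C} (_ , maximal) u empty =
    empty (u , maximal ⁅ u ⁆ (λ x∈C → ⊥-elim (empty (_ , x∈C))) singletonJoined (x∈⁅x⁆ u))
    where
    singletonJoined : AllJoined Σ' ⁅ u ⁆
    singletonJoined a b a∈ b∈ rewrite x∈⁅y⁆⇒x≡y u a∈ | x∈⁅y⁆⇒x≡y u b∈ = reachable⇒joined ε

  component-complement-nonempty : ∀ {C} → IsPremiseComponent Σ' C → ¬ PremiseConnected Σ' → ¬ Empty (∁ C)
  component-complement-nonempty {C} (joined , _) disconnected empty =
    disconnected λ u v → joined u v (inC u) (inC v)
    where
    inC : ∀ u → u ∈ₛ C
    inC u = x∉∁p⇒x∈p (λ u∈∁C → empty (u , u∈∁C))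

  premise-in-component-or-complement : ∀ {C s} → IsPremiseComponent Σ' C → s ∈ᵢ Σ' → Nonempty (premise s) →
    premise s ⊆ C ⊎ premise s ⊆ ∁ C
  premise-in-component-or-complement {C} {s} component s∈Σ (u , u∈) with u ∈? C
  ... | yes u∈C = inj₁ λ x∈ → component-closed component u∈C (s , s∈Σ , u∈ , x∈)
  ... | no u∉C = inj₂ λ x∈ → x∉p⇒x∈∁p λ x∈C → u∉C (component-closed component x∈C (s , s∈Σ , x∈ , u∈))

module _ {n : ℕ} where

  _∈ᵢ?_ : (s : Imp n) (L : Base n) → Dec (s ∈ᵢ L)
  _∈ᵢ?_ = DecMembership._∈?_ _≟ᵢ_

  LabelledBy : Base n → Tree n → Set
  LabelledBy Σ' t = ∀ L → L ∈ labels t → ∀ s → s ∈ᵢ L → s ∈ᵢ Σ'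

  Inside : Subset n → Imp n → Set
  Inside X s = premise s ⊆ X × concl s ∈ₛ X

  inside? : ∀ X s → Dec (Inside X s)
  inside? X s = (premise s ⊆? X) ×-dec (concl s ∈? X)

  ∈-restrict⁻ : ∀ {Σ' X s} → s ∈ᵢ restrict Σ' X → s ∈ᵢ Σ' × Inside X s
  ∈-restrict⁻ {X = X} = ∈-filter⁻ (inside? X)

  ∈-restrict⁺ : ∀ {Σ' X s} → s ∈ᵢ Σ' → Inside X s → s ∈ᵢ restrict Σ' X
  ∈-restrict⁺ {X = X} = ∈-filter⁺ (inside? X)

  inside-∁-disjoint : ∀ {X s} → Nonempty (premise s) → Inside X s → ¬ Inside (∁ X) s
  inside-∁-disjoint (u , u∈) (⊆X , _) (⊆∁X , _) = x∈∁p⇒x∉p (⊆∁X u∈) (⊆X u∈)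

  labelled-left : ∀ {Σ' L l r} → LabelledBy Σ' (node L l r) → LabelledBy Σ' l
  labelled-left labelled L′ L′∈ = labelled L′ (there (∈-++⁺ˡ L′∈))

  labelled-right : ∀ {Σ' L l} r → LabelledBy Σ' (node L l r) → LabelledBy Σ' r
  labelled-right {l = l} r labelled L′ L′∈ = labelled L′ (there (∈-++⁺ʳ (labels l) L′∈))

  occurrences-children : ∀ s (l r : Tree n) →
    length (filter (s ∈ᵢ?_) (labels l ++ labels r)) ≡ occurrences s l + occurrences s r
  occurrences-children s l r = begin
    length (filter (s ∈ᵢ?_) (labels l ++ labels r))
      ≡⟨ cong length (filter-++ (s ∈ᵢ?_) (labels l) (labels r)) ⟩
    length (filter (s ∈ᵢ?_) (labels l) ++ filter (s ∈ᵢ?_) (labels r))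
      ≡⟨ length-++ (filter (s ∈ᵢ?_) (labels l)) ⟩
    occurrences s l + occurrences s r ∎
    where open ≡-Reasoning

  occurrences-node-∈ : ∀ {s L} l r → s ∈ᵢ L →
    occurrences s (node L l r) ≡ suc (occurrences s l + occurrences s r)
  occurrences-node-∈ {s} l r s∈L =
    trans (cong length (filter-accept (s ∈ᵢ?_) s∈L)) (cong suc (occurrences-children s l r))

  occurrences-node-∉ : ∀ {s L} l r → ¬ s ∈ᵢ L →
    occurrences s (node L l r) ≡ occurrences s l + occurrences s r
  occurrences-node-∉ {s} l r s∉L =
    trans (cong length (filter-reject (s ∈ᵢ?_) s∉L)) (occurrences-children s l r)

  occurrences-∉ : ∀ {Σ' s t} → LabelledBy Σ' t → ¬ s ∈ᵢ Σ' → occurrences s t ≡ 0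
  occurrences-∉ {s = s} labelled s∉Σ =
    cong length (filter-none (s ∈ᵢ?_) (All.tabulate λ L∈ s∈L → s∉Σ (labelled _ L∈ s s∈L)))

  occurrences-outside : ∀ {Σ' Y s t} → LabelledBy (restrict Σ' Y) t → ¬ Inside Y s → occurrences s t ≡ 0
  occurrences-outside {Σ'} labelled notInside = occurrences-∉ labelled (notInside ∘ proj₂ ∘ ∈-restrict⁻ {Σ'})

  Splits : Imp n → List (Fin n) → List (Fin n) → Set
  Splits s ls rs = (SubsetIn (premise s) ls × concl s ∈ₗ rs) ⊎ (SubsetIn (premise s) rs × concl s ∈ₗ ls)

  splits-inside : ∀ {X s ls rs ls′ rs′} → Inside X s →
    (∀ {u} → u ∈ ls → u ∈ₛ X → u ∈ ls′) → (∀ {u} → u ∈ rs → u ∈ₛ X → u ∈ rs′) →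
    Splits s ls rs → Splits s ls′ rs′
  splits-inside (⊆X , b∈X) toL toR (inj₁ (A⊆ls , b∈rs)) =
    inj₁ ((λ u u∈A → toL (A⊆ls u u∈A) (⊆X u∈A)) , toR b∈rs b∈X)
  splits-inside (⊆X , b∈X) toL toR (inj₂ (A⊆rs , b∈ls)) =
    inj₂ ((λ u u∈A → toR (A⊆rs u u∈A) (⊆X u∈A)) , toL b∈ls b∈X)

  splits-meets : ∀ {X s ls rs} → Inside X s → Nonempty (premise s) → Splits s ls rs →
    (∃ λ u → u ∈ ls × u ∈ₛ X) × (∃ λ u → u ∈ rs × u ∈ₛ X)
  splits-meets {s = s} (⊆X , b∈X) (a , a∈A) (inj₁ (A⊆ls , b∈rs)) =
    (a , A⊆ls a a∈A , ⊆X a∈A) , (concl s , b∈rs , b∈X)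
  splits-meets {s = s} (⊆X , b∈X) (a , a∈A) (inj₂ (A⊆rs , b∈ls)) =
    (concl s , b∈ls , b∈X) , (a , A⊆rs a a∈A , ⊆X a∈A)

  graft : Base n → Maybe (Tree n) → Maybe (Tree n) → Maybe (Tree n)
  graft L nothing  r′ = r′
  graft L (just l) nothing = just l
  graft L (just l) (just r) = just (node L l r)

  prune : Subset n → Tree n → Maybe (Tree n)
  prune X (leaf u) with u ∈? X
  ... | yes _ = just (leaf u)
  ... | no _ = nothing
  prune X (node L l r) = graft (filter (inside? X) L) (prune X l) (prune X r)

  leavesᴹ : Maybe (Tree n) → List (Fin n)
  leavesᴹ = maybe leaves []

  occurrencesᴹ : Imp n → Maybe (Tree n) → ℕ
  occurrencesᴹ s = maybe (occurrences s) 0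

  leaves-graft : ∀ L l′ r′ → leavesᴹ (graft L l′ r′) ≡ leavesᴹ l′ ++ leavesᴹ r′
  leaves-graft L nothing r′ = refl
  leaves-graft L (just l) nothing = sym (++-identityʳ (leaves l))
  leaves-graft L (just l) (just r) = refl

  leaves-prune : ∀ X t → leavesᴹ (prune X t) ≡ filter (_∈? X) (leaves t)
  leaves-prune X (leaf u) with u ∈? X
  ... | yes _ = refl
  ... | no _ = refl
  leaves-prune X (node L l r) = begin
    leavesᴹ (graft _ (prune X l) (prune X r))         ≡⟨ leaves-graft _ (prune X l) (prune X r) ⟩
    leavesᴹ (prune X l) ++ leavesᴹ (prune X r)         ≡⟨ cong₂ _++_ (leaves-prune X l) (leaves-prune X r) ⟩
    filter (_∈? X) (leaves l) ++ filter (_∈? X) (leaves r) ≡⟨ filter-++ (_∈? X) (leaves l) (leaves r) ⟨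
    filter (_∈? X) (leaves (node L l r))               ∎
    where open ≡-Reasoning

  ∈-leaves-prune⁺ : ∀ {X} t {u} → u ∈ leaves t → u ∈ₛ X → u ∈ leavesᴹ (prune X t)
  ∈-leaves-prune⁺ {X} t u∈ u∈X = subst (_ ∈_) (sym (leaves-prune X t)) (∈-filter⁺ (_∈? X) u∈ u∈X)

  ∈-leaves-prune⁻ : ∀ {X} t {u} → u ∈ leavesᴹ (prune X t) → u ∈ leaves t × u ∈ₛ X
  ∈-leaves-prune⁻ {X} t u∈ = ∈-filter⁻ (_∈? X) (subst (_ ∈_) (leaves-prune X t) u∈)

  unique-prune : ∀ {X} t → Unique (leaves t) → Unique (leavesᴹ (prune X t))
  unique-prune {X} t unique = subst Unique (sym (leaves-prune X t)) (UniqueProperties.filter⁺ (_∈? X) unique)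

  separated-prune : ∀ {X} t → Separated t → Allᴹ Separated (prune X t)
  separated-prune {X} (leaf u) _ with u ∈? X
  ... | yes _ = just _
  ... | no _ = nothing
  separated-prune {X} (node L l r) (splitsL , sepl , sepr)
    with prune X l | prune X r | separated-prune {X} l sepl | separated-prune {X} r sepr
       | ∈-leaves-prune⁺ {X} l | ∈-leaves-prune⁺ {X} r
  ... | nothing | _ | _ | sepr′ | _ | _ = sepr′
  ... | just _ | nothing | sepl′ | _ | _ | _ = sepl′
  ... | just _ | just _ | just sepl′ | just sepr′ | toL | toR = just (splits , sepl′ , sepr′)
    where
    splits : ∀ s → s ∈ᵢ filter (inside? X) L → Splits s _ _
    splits s s∈ with s∈L , inside ← ∈-filter⁻ (inside? X) s∈ = splits-inside inside toL toR (splitsL s s∈L)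

  labelled-prune : ∀ {Σ' X} t → LabelledBy Σ' t → Allᴹ (LabelledBy (restrict Σ' X)) (prune X t)
  labelled-prune {X = X} (leaf u) _ with u ∈? X
  ... | yes _ = just λ _ ()
  ... | no _ = nothing
  labelled-prune {Σ'} {X} (node L l r) labelled
    with prune X l | prune X r | labelled-prune {X = X} l (labelled-left labelled)
       | labelled-prune {X = X} r (labelled-right r labelled)
  ... | nothing | _ | _ | labr = labr
  ... | just _ | nothing | labl | _ = labl
  ... | just l′ | just r′ | just labl | just labr = just labelledNode
    where
    labelledNode : LabelledBy (restrict Σ' X) (node (filter (inside? X) L) l′ r′)
    labelledNode _ (here refl) s s∈ with s∈L , inside ← ∈-filter⁻ (inside? X) s∈ =
      ∈-restrict⁺ (labelled L (here refl) s s∈L) inside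
    labelledNode L′ (there L′∈) with ∈-++⁻ (labels l′) L′∈
    ... | inj₁ L′∈l = labl L′ L′∈l
    ... | inj₂ L′∈r = labr L′ L′∈r

  Is-just-leavesᴹ : ∀ {m : Maybe (Tree n)} {u} → u ∈ leavesᴹ m → Is-just m
  Is-just-leavesᴹ {just _} _ = just _

  occurrences-node-cong : ∀ {s L L′} l r l′ r′ → (s ∈ᵢ L′ → s ∈ᵢ L) → (s ∈ᵢ L → s ∈ᵢ L′) →
    occurrences s l′ ≡ occurrences s l → occurrences s r′ ≡ occurrences s r →
    occurrences s (node L′ l′ r′) ≡ occurrences s (node L l r)
  occurrences-node-cong {s} {L} {L′} l r l′ r′ toL toL′ eql eqr = byMembership (s ∈ᵢ? L)
    where
    open ≡-Reasoning
    byMembership : Dec (s ∈ᵢ L) → occurrences s (node L′ l′ r′) ≡ occurrences s (node L l r)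
    byMembership (yes s∈L) = begin
      occurrences s (node L′ l′ r′)             ≡⟨ occurrences-node-∈ l′ r′ (toL′ s∈L) ⟩
      suc (occurrences s l′ + occurrences s r′) ≡⟨ cong suc (cong₂ _+_ eql eqr) ⟩
      suc (occurrences s l + occurrences s r)   ≡⟨ occurrences-node-∈ l r s∈L ⟨
      occurrences s (node L l r)                ∎
    byMembership (no s∉L) = begin
      occurrences s (node L′ l′ r′)        ≡⟨ occurrences-node-∉ l′ r′ (s∉L ∘ toL) ⟩
      occurrences s l′ + occurrences s r′  ≡⟨ cong₂ _+_ eql eqr ⟩
      occurrences s l + occurrences s r    ≡⟨ occurrences-node-∉ l r s∉L ⟨
      occurrences s (node L l r)           ∎

  occurrences-graft : ∀ {s L L′} l r (l′ r′ : Maybe (Tree n)) →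
    (s ∈ᵢ L′ → s ∈ᵢ L) → (s ∈ᵢ L → s ∈ᵢ L′) → (s ∈ᵢ L → Is-just l′ × Is-just r′) →
    occurrencesᴹ s l′ ≡ occurrences s l → occurrencesᴹ s r′ ≡ occurrences s r →
    occurrencesᴹ s (graft L′ l′ r′) ≡ occurrences s (node L l r)
  occurrences-graft {s} {L} l r nothing r′ _ _ justs eql eqr = begin
    occurrencesᴹ s r′                    ≡⟨ cong₂ _+_ eql eqr ⟩
    occurrences s l + occurrences s r    ≡⟨ occurrences-node-∉ l r (λ s∈L → case proj₁ (justs s∈L) of λ ()) ⟨
    occurrences s (node L l r)           ∎
    where open ≡-Reasoning
  occurrences-graft {s} {L} l r (just l′) nothing _ _ justs eql eqr = begin
    occurrences s l′                     ≡⟨ +-identityʳ _ ⟨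
    occurrences s l′ + 0                 ≡⟨ cong₂ _+_ eql eqr ⟩
    occurrences s l + occurrences s r    ≡⟨ occurrences-node-∉ l r (λ s∈L → case proj₂ (justs s∈L) of λ ()) ⟨
    occurrences s (node L l r)           ∎
    where open ≡-Reasoning
  occurrences-graft l r (just l′) (just r′) toL toL′ _ eql eqr =
    occurrences-node-cong l r l′ r′ toL toL′ eql eqr

  occurrences-prune : ∀ {X s} t → Separated t → Inside X s → Nonempty (premise s) →
    occurrencesᴹ s (prune X t) ≡ occurrences s t
  occurrences-prune {X} (leaf u) _ _ _ with u ∈? X
  ... | yes _ = refl
  ... | no _ = refl
  occurrences-prune {X} {s} (node L l r) (splitsL , sepl , sepr) inside nonempty =
    occurrences-graft l r (prune X l) (prune X r)
      (proj₁ ∘ ∈-filter⁻ (inside? X)) (λ s∈L → ∈-filter⁺ (inside? X) s∈L inside) bothPruned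
      (occurrences-prune l sepl inside nonempty) (occurrences-prune r sepr inside nonempty)
    where
    pruned : ∀ t → (∃ λ u → u ∈ leaves t × u ∈ₛ X) → Is-just (prune X t)
    pruned t (_ , u∈ , u∈X) = Is-just-leavesᴹ (∈-leaves-prune⁺ t u∈ u∈X)
    bothPruned : s ∈ᵢ L → Is-just (prune X l) × Is-just (prune X r)
    bothPruned s∈L with meetsL , meetsR ← splits-meets inside nonempty (splitsL s s∈L) =
      pruned l meetsL , pruned r meetsR

  restrict-HDecomposable : ∀ {Σ'} → IsBaseOver ⊤ Σ' → HDecomposable ⊤ Σ' →
    ∀ X → HDecomposable X (restrict Σ' X)
  restrict-HDecomposable _ (inj₁ empty) X = inj₁ λ (u , _) → empty (u , ∈⊤)
  restrict-HDecomposable {Σ'} base (inj₂ (t , _ , covers , unique , labelled , separated , once)) X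
    with prune X t | ∈-leaves-prune⁺ {X} t | ∈-leaves-prune⁻ {X} t | unique-prune {X} t unique
       | labelled-prune {X = X} t labelled | separated-prune {X} t separated
       | (λ {s} → occurrences-prune {X} {s} t separated)
  ... | nothing | toPruned | _ | _ | _ | _ | _ =
    inj₁ λ (u , u∈X) → case toPruned (covers u ∈⊤) u∈X of λ ()
  ... | just t′ | toPruned | fromPruned | unique′ | just labelled′ | just separated′ | occurrences′ =
    inj₂ (t′ , (λ u u∈ → proj₂ (fromPruned u∈)) , (λ u u∈X → toPruned (covers u ∈⊤) u∈X)
             , unique′ , labelled′ , separated′ , once′)
    where
    once′ : ∀ s → s ∈ᵢ restrict Σ' X → occurrences s t′ ≡ 1
    once′ s s∈ with s∈Σ , inside ← ∈-restrict⁻ {Σ'} s∈ =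
      trans (occurrences′ inside (proj₁ (base s s∈Σ))) (once s s∈Σ)

module _ {n : ℕ} {Σ' : Base n} (X : Subset n) where

  Crossing : Imp n → Set
  Crossing s = ¬ Inside X s × ¬ Inside (∁ X) s

  crossing? : ∀ s → Dec (Crossing s)
  crossing? s = ¬? (inside? X s) ×-dec ¬? (inside? (∁ X) s)

  crossings : Base n
  crossings = filter crossing? Σ'

  ∈-crossings⁻ : ∀ {s} → s ∈ᵢ crossings → s ∈ᵢ Σ' × Crossing s
  ∈-crossings⁻ = ∈-filter⁻ crossing? {xs = Σ'}

  Sides : Set
  Sides = ∀ {s} → s ∈ᵢ Σ' → premise s ⊆ X ⊎ premise s ⊆ ∁ X

  crossings-split : Sides → ∀ {ls rs} → (∀ u → u ∈ₛ X → u ∈ ls) → (∀ u → u ∈ₛ ∁ X → u ∈ rs) →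
    ∀ s → s ∈ᵢ crossings → Splits s ls rs
  crossings-split sides inL inR s s∈ with s∈Σ , notInX , notIn∁X ← ∈-crossings⁻ s∈ | sides s∈Σ | concl s ∈? X
  ... | inj₁ A⊆X | yes b∈X = ⊥-elim (notInX (A⊆X , b∈X))
  ... | inj₁ A⊆X | no b∉X = inj₁ ((λ u u∈A → inL u (A⊆X u∈A)) , inR _ (x∉p⇒x∈∁p b∉X))
  ... | inj₂ A⊆∁X | yes b∈X = inj₂ ((λ u u∈A → inR u (A⊆∁X u∈A)) , inL _ b∈X)
  ... | inj₂ A⊆∁X | no b∉X = ⊥-elim (notIn∁X (A⊆∁X , x∉p⇒x∈∁p b∉X))

  occurrences-crossings-node : ∀ {t₁ t₂} → IsBaseOver ⊤ Σ' →
    IsΣTree X (restrict Σ' X) t₁ → IsΣTree (∁ X) (restrict Σ' (∁ X)) t₂ →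
    ∀ s → s ∈ᵢ Σ' → occurrences s (node crossings t₁ t₂) ≡ 1
  occurrences-crossings-node {t₁} {t₂} base (_ , _ , _ , labelled₁ , _ , once₁)
                                             (_ , _ , _ , labelled₂ , _ , once₂) s s∈Σ
    with inside? X s | inside? (∁ X) s
  ... | yes inX | _ = begin
    occurrences s (node crossings t₁ t₂)
      ≡⟨ occurrences-node-∉ t₁ t₂ (λ s∈ → proj₁ (proj₂ (∈-crossings⁻ s∈)) inX) ⟩
    occurrences s t₁ + occurrences s t₂
      ≡⟨ cong₂ _+_ (once₁ s (∈-restrict⁺ s∈Σ inX))
                   (occurrences-outside {Σ' = Σ'} labelled₂ (inside-∁-disjoint (proj₁ (base s s∈Σ)) inX)) ⟩
    1 ∎
    where open ≡-Reasoning
  ... | no notInX | yes in∁X = begin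
    occurrences s (node crossings t₁ t₂)
      ≡⟨ occurrences-node-∉ t₁ t₂ (λ s∈ → proj₂ (proj₂ (∈-crossings⁻ s∈)) in∁X) ⟩
    occurrences s t₁ + occurrences s t₂
      ≡⟨ cong₂ _+_ (occurrences-outside {Σ' = Σ'} labelled₁ notInX) (once₂ s (∈-restrict⁺ s∈Σ in∁X)) ⟩
    1 ∎
    where open ≡-Reasoning
  ... | no notInX | no notIn∁X = begin
    occurrences s (node crossings t₁ t₂)
      ≡⟨ occurrences-node-∈ t₁ t₂ (∈-filter⁺ crossing? s∈Σ (notInX , notIn∁X)) ⟩
    suc (occurrences s t₁ + occurrences s t₂)
      ≡⟨ cong suc (cong₂ _+_ (occurrences-outside {Σ' = Σ'} labelled₁ notInX)
                             (occurrences-outside {Σ' = Σ'} labelled₂ notIn∁X)) ⟩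
    1 ∎
    where open ≡-Reasoning

  node-ΣTree : ∀ {t₁ t₂} → IsBaseOver ⊤ Σ' → Sides →
    IsΣTree X (restrict Σ' X) t₁ → IsΣTree (∁ X) (restrict Σ' (∁ X)) t₂ →
    IsΣTree ⊤ Σ' (node crossings t₁ t₂)
  node-ΣTree {t₁} {t₂} base sides tree₁@(inX₁ , covers₁ , unique₁ , labelled₁ , separated₁ , _)
                                  tree₂@(inX₂ , covers₂ , unique₂ , labelled₂ , separated₂ , _) =
      (λ _ _ → ∈⊤) , covers , UniqueProperties.++⁺ unique₁ unique₂ disjoint , labelled
    , (crossings-split sides covers₁ covers₂ , separated₁ , separated₂)
    , occurrences-crossings-node base tree₁ tree₂
    where
    covers : ∀ u → u ∈ₛ ⊤ → u ∈ leaves t₁ ++ leaves t₂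
    covers u _ with u ∈? X
    ... | yes u∈X = ∈-++⁺ˡ (covers₁ u u∈X)
    ... | no u∉X = ∈-++⁺ʳ (leaves t₁) (covers₂ u (x∉p⇒x∈∁p u∉X))

    disjoint : ∀ {u} → ¬ (u ∈ leaves t₁ × u ∈ leaves t₂)
    disjoint (u∈₁ , u∈₂) = x∈∁p⇒x∉p (inX₂ _ u∈₂) (inX₁ _ u∈₁)

    labelled : LabelledBy Σ' (node crossings t₁ t₂)
    labelled _ (here refl) s s∈ = proj₁ (∈-crossings⁻ s∈)
    labelled L (there L∈) s s∈L with ∈-++⁻ (labels t₁) L∈
    ... | inj₁ L∈₁ = proj₁ (∈-restrict⁻ {Σ' = Σ'} (labelled₁ L L∈₁ s s∈L))
    ... | inj₂ L∈₂ = proj₁ (∈-restrict⁻ {Σ' = Σ'} (labelled₂ L L∈₂ s s∈L))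

disconnected-element : ∀ {n} {Σ' : Base n} → ¬ PremiseConnected Σ' → Fin n
disconnected-element {zero} disconnected = ⊥-elim (disconnected λ ())
disconnected-element {suc _} _ = Fin.zero

theorem1 : (n : ℕ) (Σ' : Base n) → IsBaseOver ⊤ Σ' → ¬ PremiseConnected Σ' →
    (C : Subset n) → IsPremiseComponent Σ' C →
    HDecomposable ⊤ Σ' ⇔ (HDecomposable C (restrict Σ' C) × HDecomposable (∁ C) (restrict Σ' (∁ C)))
theorem1 n Σ' base disconnected C component = mk⇔
  (λ h → restrict-HDecomposable base h C , restrict-HDecomposable base h (∁ C))
  λ where
    (inj₁ empty , _) → ⊥-elim (component-nonempty component (disconnected-element disconnected) empty)
    (_ , inj₁ empty) → ⊥-elim (component-complement-nonempty component disconnected empty)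
    (inj₂ (t₁ , tree₁) , inj₂ (t₂ , tree₂)) →
      inj₂ (_ , node-ΣTree C base premiseSide tree₁ tree₂)
  where
  premiseSide : Sides {Σ' = Σ'} C
  premiseSide s∈Σ = premise-in-component-or-complement component s∈Σ (proj₁ (base _ s∈Σ))
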